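{- For a nonnegative integer $n$, let $R(n)$ denote the number of 2-colored Rogers-Ramanujan partitions of $n$ (with $R(0)=1$, counting the empty partition). Then, as formal power series in $q$ (equivalently, for $|q|<1$), $$\sum_{n\geq 0} R(n)q^n=\frac{(-q;q)_\infty\,(q^2,q^2,q^4;q^4)_\infty}{(q;q)_\infty}.$$
   Context: A 2-colored Rogers-Ramanujan partition of $n$ is a partition of $n$ into positive integer parts, each part colored with one of two colors (say black or red), such that: (i) within each color, any two consecutive parts (in the ordering of the parts of that color) differ by at least $2$ (so in particular parts of the same color are distinct); (ii) parts of different colors do not coincide, i.e. no integer occurs as a part in both colors. Two such partitions are different if they differ as multisets of (part, color) pairs. For example, the 2-colored Rogers-Ramanujan partitions of $6$ are $6$ (either color), $5+1$ (four colorings), $4+2$ (four colorings), and $3+2+1$ with colors red, black, red or black, red, black for $3,2,1$ respectively; there are $12$ of them. Notation: $(a;q)_n=\prod_{i=0}^{n-1}(1-aq^i)$, $(a;q)_\infty=\lim_{n\to\infty}(a;q)_n$, and $(a_1,\dots,a_k;q)_\infty=(a_1;q)_\infty\cdots(a_k;q)_\infty$. -}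

module Defs where

open import Data.Nat using (ℕ; zero; suc; _≤_; _<_; _+_; _∸_; _*_; _≡ᵇ_)
open import Data.Integer using (ℤ; 0ℤ; 1ℤ; -1ℤ) renaming (_+_ to _+ℤ_; _*_ to _*ℤ_)
open import Data.Bool using (Bool; true; false; if_then_else_)
open import Data.List using (List; []; _∷_; map; upTo; foldr)
open import Data.List.Relation.Unary.All using (All)
open import Data.List.Relation.Unary.Linked using (Linked)
open import Data.Product using (_×_; _,_; proj₁; proj₂)
open import Relation.Binary.PropositionalEquality using (_≡_)

-- Since in a
-- 2-colored RR partition all parts are distinct (same color: differ by
-- ≥ 2; different colors: never coincide), each such multiset has a
-- unique canonical representative: the list sorted strictly decreasingly
-- by part.  We require this canonical form, so lists ↔ multisets.

ColPart : Set
ColPart = List (ℕ × Bool)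

sameColor : Bool → Bool → Bool
sameColor true  true  = true
sameColor false false = true
sameColor _     _     = false

partsOf : Bool → ColPart → List ℕ
partsOf c [] = []
partsOf c ((a , d) ∷ xs) =
  if sameColor c d then a ∷ partsOf c xs else partsOf c xs

partSum : ColPart → ℕ
partSum = foldr (λ x s → proj₁ x + s) 0

GapTwo : ℕ → ℕ → Set
GapTwo a b = b + 2 ≤ a

IsRR2 : ℕ → ColPart → Set
IsRR2 n p =
    All (λ x → 1 ≤ proj₁ x) p
  × Linked (λ x y → proj₁ y < proj₁ x) p
  × Linked GapTwo (partsOf true p)
  × Linked GapTwo (partsOf false p)
  × partSum p ≡ n

Series : Set
Series = ℕ → ℤ

sumℤ : List ℤ → ℤ
sumℤ = foldr _+ℤ_ 0ℤ

_⊛_ : Series → Series → Series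
(f ⊛ g) n = sumℤ (map (λ i → f i *ℤ g (n ∸ i)) (upTo (suc n)))

infixl 7 _⊛_

one : Series
one zero    = 1ℤ
one (suc _) = 0ℤ

-- 1 + c q^d   (used only with d ≥ 1)
binom : ℤ → ℕ → Series
binom c d n = one n +ℤ (if n ≡ᵇ d then c else 0ℤ)

-- 1/(1 - q^d) = Σ_{j ≥ 0} q^{d j}   (used only with d ≥ 1)
geom : ℕ → Series
geom d n = sumℤ (map (λ j → if (j * d) ≡ᵇ n then 1ℤ else 0ℤ) (upTo (suc n)))

prodTo : (ℕ → Series) → ℕ → Series
prodTo F zero    = one
prodTo F (suc N) = prodTo F N ⊛ F (suc N)

-- Infinite product ∏_{k ≥ 1} F k, for factors with F k ≡ 1 (mod q^k):
-- the coefficient of q^n is already determined by the first n factors.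
infProd : (ℕ → Series) → Series
infProd F n = prodTo F n n

negqq : Series
negqq = infProd (λ k → binom 1ℤ k)

q2q4 : Series
q2q4 = infProd (λ k → binom -1ℤ (4 * k ∸ 2))

q4q4 : Series
q4q4 = infProd (λ k → binom -1ℤ (4 * k))

invqq : Series
invqq = infProd (λ k → geom k)

rhsSeries : Series
rhsSeries = negqq ⊛ q2q4 ⊛ q2q4 ⊛ q4q4 ⊛ invqq

{-# OPTIONS --safe #-}
-- Read the parts of a partition in increasing order. Let E p (resp. H p) be the generating function
-- of the partitions all of whose parts exceed p (resp. which in addition may not use one given colour
-- at p + 1, because a part p of that colour precedes them). Deciding whether p + 1 is a part, and of
-- which colour, gives
--   E p = E (p+1) + 2 q^(p+1) H (p+1)   and   H p = E (p+1) + q^(p+1) H (p+1).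
-- These are solved by E p = A p (p+1) and H p = A (p+1) (p+1), where
-- A s a = Σₖ q^(sk+k²) (-q^(k+a);q)∞ / (q;q)ₖ obeys
--   A s a = A s (a+1) + q^a A (s+1) (a+1)   and   A s a = A (s+1) a + q^(s+1) A (s+2) (a+1).
-- Combining the two gives A s 1 = (1 + q^(s+1)) A (s+2) 1, whence Σ R(n) qⁿ = E 0 = A 0 1 equals
-- (-q;q)∞ (-q;q²)∞. This is the stated product, since (q;q)∞ = (q;q²)∞ (q²;q⁴)∞ (q⁴;q⁴)∞ and
-- (-q;q²)∞ (q;q²)∞ = (q²;q⁴)∞.
module Submission where

open import Defs
open import Algebra.Bundles using (CommutativeMonoid)
import Algebra.Properties.CommutativeSemigroup as CommutativeSemigroupProperties
open import Data.Bool using (Bool; true; false; not; if_then_else_; T)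
open import Data.Integer using (ℤ; +_; 0ℤ; 1ℤ; -1ℤ) renaming (_+_ to _+ℤ_; _*_ to _*ℤ_)
import Data.Integer.Properties as ℤ
open import Data.Integer.Tactic.RingSolver using (solve-∀)
open import Data.List using (List; []; _∷_; _++_; map; reverse; reverseAcc; length; applyUpTo)
open import Data.List.Properties
  using (map-upTo; foldr-map; length-++; length-map; ∷-injectiveʳ; reverse-injective; reverse-involutive)
open import Data.List.Membership.Propositional using (_∈_)
open import Data.List.Membership.Propositional.Properties using (∈-map⁻; ∈-map⁺; ∈-++⁻; ∈-++⁺ˡ; ∈-++⁺ʳ)
open import Data.List.Relation.Binary.Disjoint.Propositional using (Disjoint)
open import Data.List.Relation.Binary.Permutation.Propositional using (↭-sym)
open import Data.List.Relation.Binary.Permutation.Propositional.Properties using (↭-reverse; All-resp-↭; map⁺)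
open import Data.List.Relation.Unary.All as All using (All; []; _∷_)
open import Data.List.Relation.Unary.AllPairs using ([]; _∷_)
open import Data.List.Relation.Unary.Any using (here)
open import Data.List.Relation.Unary.Linked as Linked using (Linked; []; [-]; _∷_)
open import Data.List.Relation.Unary.Linked.Properties using (Linked⇒All)
open import Data.List.Relation.Unary.Unique.Propositional using (Unique)
import Data.List.Relation.Unary.Unique.Propositional.Properties as Unique
open import Data.Maybe using (Maybe; just; nothing)
open import Data.Maybe.Relation.Binary.Connected as Connected using (Connected; just-nothing)
open import Data.Nat using (ℕ; zero; suc; _+_; _*_; _∸_; _≤_; _<_; _≡ᵇ_; _≟_; z≤n; s≤s)
open import Data.Nat.ListAction using (sum)
open import Data.Nat.ListAction.Properties using (sum-↭)
open import Data.Nat.Properties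
open import Data.Product using (Σ; ∃; _×_; _,_; proj₁; proj₂)
open import Data.Sum using (inj₁; inj₂)
open import Data.Unit using (⊤; tt)
open import Function using (flip)
open import Relation.Binary.Bundles using (Setoid)
open import Relation.Binary.Definitions using (Transitive)
open import Relation.Binary.PropositionalEquality
import Relation.Binary.Reasoning.Setoid as SetoidReasoning
open import Relation.Nullary using (¬_; yes; no; contradiction)

module ≗ = Setoid (ℕ →-setoid ℤ)

shift : ℕ → Series → Series
shift zero    f n       = f n
shift (suc d) f zero    = 0ℤ
shift (suc d) f (suc n) = shift d f n

shift-cong : ∀ d {f g : Series} n → (∀ m → d + m ≡ n → f m ≡ g m) → shift d f n ≡ shift d g n
shift-cong zero    n       f≡g = f≡g n refl
shift-cong (suc d) zero    f≡g = refl
shift-cong (suc d) (suc n) f≡g = shift-cong d n (λ m e → f≡g m (cong suc e))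

shift-+ : ∀ d (f g : Series) n → shift d (λ m → f m +ℤ g m) n ≡ shift d f n +ℤ shift d g n
shift-+ zero    f g n       = refl
shift-+ (suc d) f g zero    = refl
shift-+ (suc d) f g (suc n) = shift-+ d f g n

shift-shift : ∀ a b (f : Series) n → shift a (shift b f) n ≡ shift (a + b) f n
shift-shift zero    b f n       = refl
shift-shift (suc a) b f zero    = refl
shift-shift (suc a) b f (suc n) = shift-shift a b f n

shift-< : ∀ d (f : Series) {n} → n < d → shift d f n ≡ 0ℤ
shift-< (suc d) f {zero}  _         = refl
shift-< (suc d) f {suc n} (s≤s n<d) = shift-< d f n<d

conv : Series → Series → Series
conv f g zero    = f 0 *ℤ g 0
conv f g (suc n) = f 0 *ℤ g (suc n) +ℤ conv (λ i → f (suc i)) g n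

⊛≗conv : ∀ f g → f ⊛ g ≗ conv f g
⊛≗conv f g n = trans (cong sumℤ (map-upTo (λ i → f i *ℤ g (n ∸ i)) (suc n))) (sum≡conv f g n)
  where
  sum≡conv : ∀ f g n → sumℤ (applyUpTo (λ i → f i *ℤ g (n ∸ i)) (suc n)) ≡ conv f g n
  sum≡conv f g zero    = ℤ.+-identityʳ _
  sum≡conv f g (suc n) = cong (f 0 *ℤ g (suc n) +ℤ_) (sum≡conv (λ i → f (suc i)) g n)

conv-cong-≤ : ∀ {f f′ g g′} n → (∀ i → i ≤ n → f i ≡ f′ i) → (∀ i → i ≤ n → g i ≡ g′ i) →
              conv f g n ≡ conv f′ g′ n
conv-cong-≤ zero    f≡ g≡ = cong₂ _*ℤ_ (f≡ 0 z≤n) (g≡ 0 z≤n)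
conv-cong-≤ (suc n) f≡ g≡ = cong₂ _+ℤ_ (cong₂ _*ℤ_ (f≡ 0 z≤n) (g≡ (suc n) ≤-refl))
  (conv-cong-≤ n (λ i i≤n → f≡ (suc i) (s≤s i≤n)) (λ i i≤n → g≡ i (≤-trans i≤n (n≤1+n n))))

conv-zeroˡ : ∀ g n → conv (λ _ → 0ℤ) g n ≡ 0ℤ
conv-zeroˡ g zero    = ℤ.*-zeroˡ (g 0)
conv-zeroˡ g (suc n) = cong₂ _+ℤ_ (ℤ.*-zeroˡ (g (suc n))) (conv-zeroˡ g n)

conv-identityˡ : ∀ g n → conv one g n ≡ g n
conv-identityˡ g zero    = ℤ.*-identityˡ (g 0)
conv-identityˡ g (suc n) =
  trans (cong₂ _+ℤ_ (ℤ.*-identityˡ (g (suc n))) (conv-zeroˡ g n)) (ℤ.+-identityʳ _)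

conv-comm : ∀ f g n → conv f g n ≡ conv g f n
conv-comm f g zero          = ℤ.*-comm (f 0) (g 0)
conv-comm f g (suc zero)    = swap (f 0) (g 1) (f 1) (g 0)
  where
  swap : ∀ a b c d → a *ℤ b +ℤ c *ℤ d ≡ d *ℤ c +ℤ b *ℤ a
  swap = solve-∀
conv-comm f g (suc (suc n)) = begin
  f 0 *ℤ g (2 + n) +ℤ conv f′ g (suc n)
    ≡⟨ cong (f 0 *ℤ g (2 + n) +ℤ_) (conv-comm f′ g (suc n)) ⟩
  f 0 *ℤ g (2 + n) +ℤ (g 0 *ℤ f (2 + n) +ℤ conv g′ f′ n)
    ≡⟨ cong (λ t → f 0 *ℤ g (2 + n) +ℤ (g 0 *ℤ f (2 + n) +ℤ t)) (conv-comm g′ f′ n) ⟩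
  f 0 *ℤ g (2 + n) +ℤ (g 0 *ℤ f (2 + n) +ℤ conv f′ g′ n)
    ≡⟨ exchange (f 0) (g (2 + n)) (g 0) (f (2 + n)) (conv f′ g′ n) ⟩
  g 0 *ℤ f (2 + n) +ℤ (f 0 *ℤ g (2 + n) +ℤ conv f′ g′ n)
    ≡⟨ cong (g 0 *ℤ f (2 + n) +ℤ_) (conv-comm f g′ (suc n)) ⟩
  g 0 *ℤ f (2 + n) +ℤ conv g′ f (suc n)
    ∎
  where
  open ≡-Reasoning
  f′ g′ : Series
  f′ i = f (suc i)
  g′ i = g (suc i)
  exchange : ∀ a b c d e → a *ℤ b +ℤ (c *ℤ d +ℤ e) ≡ c *ℤ d +ℤ (a *ℤ b +ℤ e)
  exchange = solve-∀

conv-distribʳ : ∀ f h g n → conv (λ i → f i +ℤ h i) g n ≡ conv f g n +ℤ conv h g n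
conv-distribʳ f h g zero    = ℤ.*-distribʳ-+ (g 0) (f 0) (h 0)
conv-distribʳ f h g (suc n) =
  trans (cong ((f 0 +ℤ h 0) *ℤ g (suc n) +ℤ_) (conv-distribʳ (λ i → f (suc i)) (λ i → h (suc i)) g n))
        (regroup (f 0) (h 0) (g (suc n)) _ _)
  where
  regroup : ∀ a b x c d → (a +ℤ b) *ℤ x +ℤ (c +ℤ d) ≡ (a *ℤ x +ℤ c) +ℤ (b *ℤ x +ℤ d)
  regroup = solve-∀

conv-scaleˡ : ∀ c f g n → conv (λ i → c *ℤ f i) g n ≡ c *ℤ conv f g n
conv-scaleˡ c f g zero    = ℤ.*-assoc c (f 0) (g 0)
conv-scaleˡ c f g (suc n) =
  trans (cong (c *ℤ f 0 *ℤ g (suc n) +ℤ_) (conv-scaleˡ c (λ i → f (suc i)) g n))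
        (factor c (f 0) (g (suc n)) _)
  where
  factor : ∀ c a x d → c *ℤ a *ℤ x +ℤ c *ℤ d ≡ c *ℤ (a *ℤ x +ℤ d)
  factor = solve-∀

conv-assoc : ∀ f g h n → conv (conv f g) h n ≡ conv f (conv g h) n
conv-assoc f g h zero    = ℤ.*-assoc (f 0) (g 0) (h 0)
conv-assoc f g h (suc n) = begin
  f 0 *ℤ g 0 *ℤ h (suc n) +ℤ conv (λ i → f 0 *ℤ g (suc i) +ℤ conv f′ g i) h n
    ≡⟨ cong (f 0 *ℤ g 0 *ℤ h (suc n) +ℤ_) (conv-distribʳ (λ i → f 0 *ℤ g′ i) (conv f′ g) h n) ⟩
  f 0 *ℤ g 0 *ℤ h (suc n) +ℤ (conv (λ i → f 0 *ℤ g′ i) h n +ℤ conv (conv f′ g) h n)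
    ≡⟨ cong₂ (λ a b → f 0 *ℤ g 0 *ℤ h (suc n) +ℤ (a +ℤ b))
             (conv-scaleˡ (f 0) g′ h n) (conv-assoc f′ g h n) ⟩
  f 0 *ℤ g 0 *ℤ h (suc n) +ℤ (f 0 *ℤ conv g′ h n +ℤ conv f′ (conv g h) n)
    ≡⟨ factor (f 0) (g 0) (h (suc n)) _ _ ⟩
  f 0 *ℤ (g 0 *ℤ h (suc n) +ℤ conv g′ h n) +ℤ conv f′ (conv g h) n
    ∎
  where
  open ≡-Reasoning
  f′ g′ : Series
  f′ i = f (suc i)
  g′ i = g (suc i)
  factor : ∀ a b x c d → a *ℤ b *ℤ x +ℤ (a *ℤ c +ℤ d) ≡ a *ℤ (b *ℤ x +ℤ c) +ℤ d
  factor = solve-∀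

⊛-cong : ∀ {f f′ g g′} → f ≗ f′ → g ≗ g′ → f ⊛ g ≗ f′ ⊛ g′
⊛-cong {f} {f′} {g} {g′} f≗ g≗ n =
  trans (⊛≗conv f g n) (trans (conv-cong-≤ n (λ i _ → f≗ i) (λ i _ → g≗ i)) (sym (⊛≗conv f′ g′ n)))

⊛-congˡ : ∀ {f f′} g → f ≗ f′ → f ⊛ g ≗ f′ ⊛ g
⊛-congˡ {f} {f′} g f≗ = ⊛-cong {f} {f′} {g} {g} f≗ λ _ → refl

⊛-congʳ : ∀ f {g g′} → g ≗ g′ → f ⊛ g ≗ f ⊛ g′
⊛-congʳ f {g} {g′} g≗ = ⊛-cong {f} {f} {g} {g′} (λ _ → refl) g≗

⊛-cong-≤ : ∀ f f′ g g′ n → (∀ i → i ≤ n → f i ≡ f′ i) → (∀ i → i ≤ n → g i ≡ g′ i) →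
           (f ⊛ g) n ≡ (f′ ⊛ g′) n
⊛-cong-≤ f f′ g g′ n f≡ g≡ =
  trans (⊛≗conv f g n) (trans (conv-cong-≤ n f≡ g≡) (sym (⊛≗conv f′ g′ n)))

⊛-comm : ∀ f g → f ⊛ g ≗ g ⊛ f
⊛-comm f g n = trans (⊛≗conv f g n) (trans (conv-comm f g n) (sym (⊛≗conv g f n)))

⊛-assoc : ∀ f g h → (f ⊛ g) ⊛ h ≗ f ⊛ (g ⊛ h)
⊛-assoc f g h n = begin
  ((f ⊛ g) ⊛ h) n       ≡⟨ ⊛≗conv (f ⊛ g) h n ⟩
  conv (f ⊛ g) h n      ≡⟨ conv-cong-≤ n (λ i _ → ⊛≗conv f g i) (λ _ _ → refl) ⟩
  conv (conv f g) h n   ≡⟨ conv-assoc f g h n ⟩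
  conv f (conv g h) n   ≡⟨ conv-cong-≤ n (λ _ _ → refl) (λ i _ → sym (⊛≗conv g h i)) ⟩
  conv f (g ⊛ h) n      ≡⟨ sym (⊛≗conv f (g ⊛ h) n) ⟩
  (f ⊛ (g ⊛ h)) n       ∎
  where open ≡-Reasoning

⊛-identityˡ : ∀ g → one ⊛ g ≗ g
⊛-identityˡ g n = trans (⊛≗conv one g n) (conv-identityˡ g n)

⊛-identityʳ : ∀ g → g ⊛ one ≗ g
⊛-identityʳ g n = trans (⊛-comm g one n) (⊛-identityˡ g n)

⊛-commutativeMonoid : CommutativeMonoid _ _
⊛-commutativeMonoid = record
  { Carrier             = Series
  ; _≈_                 = _≗_
  ; _∙_                 = _⊛_
  ; ε                   = one
  ; isCommutativeMonoid = record
    { isMonoid = record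
      { isSemigroup = record
        { isMagma = record { isEquivalence = ≗.isEquivalence ; ∙-cong = ⊛-cong }
        ; assoc   = ⊛-assoc
        }
      ; identity = ⊛-identityˡ , ⊛-identityʳ
      }
    ; comm = ⊛-comm
    }
  }

open CommutativeSemigroupProperties (CommutativeMonoid.commutativeSemigroup ⊛-commutativeMonoid)
  using () renaming (interchange to ⊛-interchange)

monomial : ℕ → Series
monomial d i = if i ≡ᵇ d then 1ℤ else 0ℤ

binom≗ : ∀ c d → binom c d ≗ λ i → one i +ℤ c *ℤ monomial d i
binom≗ c d i with i ≡ᵇ d
... | true  = cong (one i +ℤ_) (sym (ℤ.*-identityʳ c))
... | false = cong (one i +ℤ_) (sym (ℤ.*-zeroʳ c))

conv-monomialˡ : ∀ d g n → conv (monomial d) g n ≡ shift d g n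
conv-monomialˡ zero    g zero    = ℤ.*-identityˡ (g 0)
conv-monomialˡ zero    g (suc n) = conv-identityˡ g (suc n)
conv-monomialˡ (suc d) g zero    = ℤ.*-zeroˡ (g 0)
conv-monomialˡ (suc d) g (suc n) =
  trans (cong₂ _+ℤ_ (ℤ.*-zeroˡ (g (suc n))) (conv-monomialˡ d g n)) (ℤ.+-identityˡ _)

binom-⊛ : ∀ c d g n → (binom c d ⊛ g) n ≡ g n +ℤ c *ℤ shift d g n
binom-⊛ c d g n = begin
  (binom c d ⊛ g) n
    ≡⟨ ⊛≗conv (binom c d) g n ⟩
  conv (binom c d) g n
    ≡⟨ conv-cong-≤ n (λ i _ → binom≗ c d i) (λ _ _ → refl) ⟩
  conv (λ i → one i +ℤ c *ℤ monomial d i) g n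
    ≡⟨ conv-distribʳ one _ g n ⟩
  conv one g n +ℤ conv (λ i → c *ℤ monomial d i) g n
    ≡⟨ cong₂ _+ℤ_ (conv-identityˡ g n) (conv-scaleˡ c (monomial d) g n) ⟩
  g n +ℤ c *ℤ conv (monomial d) g n
    ≡⟨ cong (λ t → g n +ℤ c *ℤ t) (conv-monomialˡ d g n) ⟩
  g n +ℤ c *ℤ shift d g n
    ∎
  where open ≡-Reasoning

module _ {a} {X : Set a} (g : ℕ → X) (P : ℕ → Set)
         (up : ∀ {k} → P k → P (suc k)) (step : ∀ {k} → P k → g k ≡ g (suc k)) where

  constant-above : ∀ {k l} → P k → k ≤ l → g k ≡ g l
  constant-above {k} {l} pk k≤l = subst (λ m → g k ≡ g m) (m∸n+n≡m k≤l) (go (l ∸ k))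
    where
    P+ : ∀ j → P (j + k)
    P+ zero    = pk
    P+ (suc j) = up (P+ j)
    go : ∀ j → g k ≡ g (j + k)
    go zero    = refl
    go (suc j) = trans (go j) (step (P+ j))

  constant-on-upset : ∀ {k l} → P k → P l → g k ≡ g l
  constant-on-upset {k} {l} pk pl with ≤-total k l
  ... | inj₁ k≤l = constant-above pk k≤l
  ... | inj₂ l≤k = sym (constant-above pl l≤k)

Convergent : (ℕ → Series) → Set
Convergent F = ∀ k j → j < k → F k j ≡ one j

prodTo-stable : ∀ {F} → Convergent F → ∀ {n M N} → n ≤ M → n ≤ N → prodTo F M n ≡ prodTo F N n
prodTo-stable {F} convF {n} =
  constant-on-upset (λ M → prodTo F M n) (n ≤_) (λ n≤M → ≤-trans n≤M (n≤1+n _)) step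
  where
  step : ∀ {M} → n ≤ M → prodTo F M n ≡ prodTo F (suc M) n
  step {M} n≤M = sym (trans
    (⊛-cong-≤ (prodTo F M) (prodTo F M) (F (suc M)) one n
       (λ _ _ → refl) (λ i i≤n → convF (suc M) i (s≤s (≤-trans i≤n n≤M))))
    (⊛-identityʳ (prodTo F M) n))

infProd≡prodTo : ∀ {F} → Convergent F → ∀ {n N} → n ≤ N → infProd F n ≡ prodTo F N n
infProd≡prodTo convF n≤N = prodTo-stable convF ≤-refl n≤N

prodTo-cong : ∀ {F G} → (∀ k → F (suc k) ≗ G (suc k)) → ∀ N → prodTo F N ≗ prodTo G N
prodTo-cong F≗G zero    = λ _ → refl
prodTo-cong F≗G (suc N) = ⊛-cong (prodTo-cong F≗G N) (F≗G N)

infProd-cong : ∀ {F G} → (∀ k → F (suc k) ≗ G (suc k)) → infProd F ≗ infProd G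
infProd-cong F≗G n = prodTo-cong F≗G n n

prodTo-⊛ : ∀ F G N → prodTo F N ⊛ prodTo G N ≗ prodTo (λ k → F k ⊛ G k) N
prodTo-⊛ F G zero    = ⊛-identityˡ one
prodTo-⊛ F G (suc N) = ≗.trans (⊛-interchange (prodTo F N) (F (suc N)) (prodTo G N) (G (suc N)))
                               (⊛-congˡ _ (prodTo-⊛ F G N))

infProd-⊛ : ∀ {F G} → Convergent F → Convergent G → infProd F ⊛ infProd G ≗ infProd (λ k → F k ⊛ G k)
infProd-⊛ {F} {G} convF convG n =
  trans (⊛-cong-≤ (infProd F) (prodTo F n) (infProd G) (prodTo G n) n
           (λ i i≤n → infProd≡prodTo convF i≤n) (λ i i≤n → infProd≡prodTo convG i≤n))
        (prodTo-⊛ F G n n)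

prodTo-one : ∀ N → prodTo (λ _ → one) N ≗ one
prodTo-one zero    = λ _ → refl
prodTo-one (suc N) = ≗.trans (⊛-congˡ one (prodTo-one N)) (⊛-identityˡ one)

oddFactors evenFactors : (ℕ → Series) → ℕ → Series
oddFactors  F k = F (2 * k ∸ 1)
evenFactors F k = F (2 * k)

private
  double : ℕ → ℕ
  double zero    = zero
  double (suc N) = suc (suc (double N))

  double≡2* : ∀ N → double N ≡ 2 * N
  double≡2* zero    = refl
  double≡2* (suc N) = trans (cong (λ m → suc (suc m)) (double≡2* N)) (sym (*-suc 2 N))

  2*suc≡ : ∀ N → 2 * suc N ≡ suc (suc (double N))
  2*suc≡ N = trans (*-suc 2 N) (cong (λ m → suc (suc m)) (sym (double≡2* N)))

  n≤double : ∀ n → n ≤ double n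
  n≤double n = subst (n ≤_) (sym (double≡2* n)) (m≤n*m n 2)

prodTo-double : ∀ F N → prodTo F (double N) ≗ prodTo (oddFactors F) N ⊛ prodTo (evenFactors F) N
prodTo-double F zero    = ≗.sym (⊛-identityˡ one)
prodTo-double F (suc N) = begin
  prodTo F (double N) ⊛ F (suc (double N)) ⊛ F (suc (suc (double N)))
    ≈⟨ ⊛-congˡ _ (⊛-congˡ _ (prodTo-double F N)) ⟩
  Po ⊛ Pe ⊛ F (suc (double N)) ⊛ F (suc (suc (double N)))
    ≈⟨ ⊛-assoc (Po ⊛ Pe) _ _ ⟩
  Po ⊛ Pe ⊛ (F (suc (double N)) ⊛ F (suc (suc (double N))))
    ≈⟨ ⊛-interchange Po Pe _ _ ⟩
  Po ⊛ F (suc (double N)) ⊛ (Pe ⊛ F (suc (suc (double N))))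
    ≈⟨ ⊛-cong (⊛-congʳ Po (λ n → cong (λ m → F (m ∸ 1) n) (sym (2*suc≡ N))))
              (⊛-congʳ Pe (λ n → cong (λ m → F m n) (sym (2*suc≡ N)))) ⟩
  Po ⊛ oddFactors F (suc N) ⊛ (Pe ⊛ evenFactors F (suc N))
    ∎
  where
  open SetoidReasoning (ℕ →-setoid _)
  Po Pe : Series
  Po = prodTo (oddFactors F) N
  Pe = prodTo (evenFactors F) N

Convergent-odd : ∀ {F} → Convergent F → Convergent (oddFactors F)
Convergent-odd convF (suc k) j j<k =
  convF (2 * suc k ∸ 1) j (subst (j <_) (cong (_∸ 1) (sym (2*suc≡ k))) (≤-trans j<k (s≤s (n≤double k))))

Convergent-even : ∀ {F} → Convergent F → Convergent (evenFactors F)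
Convergent-even convF (suc k) j j<k =
  convF (2 * suc k) j (subst (j <_) (sym (2*suc≡ k)) (≤-trans j<k (s≤s (≤-trans (n≤double k) (n≤1+n _)))))

infProd-odd-even : ∀ {F} → Convergent F → infProd F ≗ infProd (oddFactors F) ⊛ infProd (evenFactors F)
infProd-odd-even {F} convF n =
  trans (infProd≡prodTo convF (n≤double n))
  (trans (prodTo-double F n n)
         (⊛-cong-≤ _ (infProd (oddFactors F)) _ (infProd (evenFactors F)) n
            (λ i i≤n → sym (infProd≡prodTo (Convergent-odd convF) i≤n))
            (λ i i≤n → sym (infProd≡prodTo (Convergent-even convF) i≤n))))

telescope : ∀ (X G : ℕ → Series) (L : Series) → Convergent G →
            (∀ j → X j ≗ G (suc j) ⊛ X (suc j)) → (∀ J n → n ≤ J → X J n ≡ L n) →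
            X 0 ≗ infProd G ⊛ L
telescope X G L convG X≗ X→L n =
  trans (peel n n)
        (⊛-cong-≤ (prodTo G n) (infProd G) (X n) L n (λ i i≤n → sym (infProd≡prodTo convG i≤n)) (X→L n))
  where
  peel : ∀ J → X 0 ≗ prodTo G J ⊛ X J
  peel zero    = ≗.sym (⊛-identityˡ (X 0))
  peel (suc J) = ≗.trans (peel J)
    (≗.trans (⊛-congʳ (prodTo G J) (X≗ J)) (≗.sym (⊛-assoc (prodTo G J) (G (suc J)) (X (suc J)))))

≡ᵇ-≢ : ∀ {m n} → m ≢ n → (m ≡ᵇ n) ≡ false
≡ᵇ-≢ {m} {n} m≢n with m ≡ᵇ n in eq
... | false = refl
... | true  = contradiction (≡ᵇ⇒≡ m n (subst T (sym eq) _)) m≢n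

monomial-≢ : ∀ {d i} → i ≢ d → monomial d i ≡ 0ℤ
monomial-≢ {d} {i} i≢d = cong (if_then 1ℤ else 0ℤ) (≡ᵇ-≢ i≢d)

monomial-zero : ∀ n → monomial n 0 ≡ one n
monomial-zero zero    = refl
monomial-zero (suc n) = refl

binom-< : ∀ c {d i} → i < d → binom c d i ≡ one i
binom-< c {d} {i} i<d =
  trans (cong (λ b → one i +ℤ (if b then c else 0ℤ)) (≡ᵇ-≢ (<⇒≢ i<d))) (ℤ.+-identityʳ (one i))

Convergent-binom : ∀ c → Convergent (binom c)
Convergent-binom c k j j<k = binom-< c j<k

shift-scale : ∀ d c (f : Series) n → shift d (λ i → c *ℤ f i) n ≡ c *ℤ shift d f n
shift-scale zero    c f n       = refl
shift-scale (suc d) c f zero    = sym (ℤ.*-zeroʳ c)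
shift-scale (suc d) c f (suc n) = shift-scale d c f n

shift-monomial : ∀ e d n → shift e (monomial d) n ≡ monomial (e + d) n
shift-monomial zero    d n       = refl
shift-monomial (suc e) d zero    = refl
shift-monomial (suc e) d (suc n) = shift-monomial e d n

sumUpTo : (ℕ → ℤ) → ℕ → ℤ
sumUpTo f m = sumℤ (applyUpTo f m)

sumUpTo-zero : ∀ f m → (∀ j → f j ≡ 0ℤ) → sumUpTo f m ≡ 0ℤ
sumUpTo-zero f zero    f≡0 = refl
sumUpTo-zero f (suc m) f≡0 = cong₂ _+ℤ_ (f≡0 0) (sumUpTo-zero (λ j → f (suc j)) m (λ j → f≡0 (suc j)))

sumUpTo-vanishing : ∀ f a m → a ≤ m → (∀ j → a ≤ j → f j ≡ 0ℤ) → sumUpTo f m ≡ sumUpTo f a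
sumUpTo-vanishing f zero    m       a≤m       f≡0 = sumUpTo-zero f m (λ j → f≡0 j z≤n)
sumUpTo-vanishing f (suc a) (suc m) (s≤s a≤m) f≡0 =
  cong (f 0 +ℤ_) (sumUpTo-vanishing (λ j → f (suc j)) a m a≤m (λ j a≤j → f≡0 (suc j) (s≤s a≤j)))

sumUpTo-monomial-+ : ∀ d (h : ℕ → ℕ) m n →
  sumUpTo (λ j → monomial n (d + h j)) m ≡ shift d (λ n′ → sumUpTo (λ j → monomial n′ (h j)) m) n
sumUpTo-monomial-+ zero    h m n       = refl
sumUpTo-monomial-+ (suc d) h m zero    = sumUpTo-zero _ m (λ _ → refl)
sumUpTo-monomial-+ (suc d) h m (suc n) = sumUpTo-monomial-+ d h m n

geom-unfold : ∀ d′ n → geom (suc d′) n ≡ one n +ℤ shift (suc d′) (geom (suc d′)) n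
geom-unfold d′ n = begin
  geom (suc d′) n
    ≡⟨ cong sumℤ (map-upTo (λ j → monomial n (j * d)) (suc n)) ⟩
  monomial n 0 +ℤ sumUpTo (λ j → monomial n (d + j * d)) n
    ≡⟨ cong₂ _+ℤ_ (monomial-zero n) (sumUpTo-monomial-+ d (_* d) n n) ⟩
  one n +ℤ shift d (λ m → sumUpTo (λ j → monomial m (j * d)) n) n
    ≡⟨ cong (one n +ℤ_) (shift-cong d n (λ m d+m≡n → sym (trim m d+m≡n))) ⟩
  one n +ℤ shift (suc d′) (geom (suc d′)) n
    ∎
  where
  open ≡-Reasoning
  d : ℕ
  d = suc d′
  trim : ∀ m → d + m ≡ n → geom d m ≡ sumUpTo (λ j → monomial m (j * d)) n
  trim m d+m≡n = trans (cong sumℤ (map-upTo (λ j → monomial m (j * d)) (suc m)))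
    (sym (sumUpTo-vanishing _ (suc m) n
      (≤-trans (+-monoˡ-≤ m (s≤s z≤n)) (≤-reflexive d+m≡n))
      (λ j m<j → monomial-≢ (λ j*d≡m → <⇒≢ (<-≤-trans m<j (m≤m*n j d)) (sym j*d≡m)))))

Convergent-geom : Convergent geom
Convergent-geom (suc k) j j<k =
  trans (geom-unfold k j) (trans (cong (one j +ℤ_) (shift-< (suc k) (geom (suc k)) j<k)) (ℤ.+-identityʳ (one j)))

geom-⊛-binom : ∀ d′ → geom (suc d′) ⊛ binom -1ℤ (suc d′) ≗ one
geom-⊛-binom d′ n = begin
  (geom d ⊛ binom -1ℤ d) n
    ≡⟨ ⊛-comm (geom d) (binom -1ℤ d) n ⟩
  (binom -1ℤ d ⊛ geom d) n
    ≡⟨ binom-⊛ -1ℤ d (geom d) n ⟩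
  geom d n +ℤ -1ℤ *ℤ shift d (geom d) n
    ≡⟨ cong (_+ℤ -1ℤ *ℤ shift d (geom d) n) (geom-unfold d′ n) ⟩
  one n +ℤ shift d (geom d) n +ℤ -1ℤ *ℤ shift d (geom d) n
    ≡⟨ cancel (one n) (shift d (geom d) n) ⟩
  one n
    ∎
  where
  open ≡-Reasoning
  d : ℕ
  d = suc d′
  cancel : ∀ a x → a +ℤ x +ℤ -1ℤ *ℤ x ≡ a
  cancel = solve-∀

shift-one : ∀ e n → shift e one n ≡ monomial e n
shift-one zero    zero    = refl
shift-one zero    (suc n) = refl
shift-one (suc e) zero    = refl
shift-one (suc e) (suc n) = shift-one e n

binom-⊛-binom : ∀ e → binom 1ℤ e ⊛ binom -1ℤ e ≗ binom -1ℤ (2 * e)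
binom-⊛-binom e n = begin
  (binom 1ℤ e ⊛ binom -1ℤ e) n
    ≡⟨ binom-⊛ 1ℤ e (binom -1ℤ e) n ⟩
  binom -1ℤ e n +ℤ 1ℤ *ℤ shift e (binom -1ℤ e) n
    ≡⟨ cong₂ (λ a b → a +ℤ 1ℤ *ℤ b) (binom≗ -1ℤ e n) shift-binom ⟩
  one n +ℤ -1ℤ *ℤ monomial e n +ℤ 1ℤ *ℤ (monomial e n +ℤ -1ℤ *ℤ monomial (e + e) n)
    ≡⟨ cancel (one n) (monomial e n) (monomial (e + e) n) ⟩
  one n +ℤ -1ℤ *ℤ monomial (e + e) n
    ≡⟨ cong (λ k → one n +ℤ -1ℤ *ℤ monomial (e + k) n) (sym (+-identityʳ e)) ⟩
  one n +ℤ -1ℤ *ℤ monomial (2 * e) n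
    ≡⟨ sym (binom≗ -1ℤ (2 * e) n) ⟩
  binom -1ℤ (2 * e) n
    ∎
  where
  open ≡-Reasoning
  shift-binom : shift e (binom -1ℤ e) n ≡ monomial e n +ℤ -1ℤ *ℤ monomial (e + e) n
  shift-binom = begin
    shift e (binom -1ℤ e) n
      ≡⟨ shift-cong e n (λ m _ → binom≗ -1ℤ e m) ⟩
    shift e (λ i → one i +ℤ -1ℤ *ℤ monomial e i) n
      ≡⟨ shift-+ e one _ n ⟩
    shift e one n +ℤ shift e (λ i → -1ℤ *ℤ monomial e i) n
      ≡⟨ cong₂ _+ℤ_ (shift-one e n) (shift-scale e -1ℤ (monomial e) n) ⟩
    monomial e n +ℤ -1ℤ *ℤ shift e (monomial e) n
      ≡⟨ cong (λ t → monomial e n +ℤ -1ℤ *ℤ t) (shift-monomial e e n) ⟩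
    monomial e n +ℤ -1ℤ *ℤ monomial (e + e) n
      ∎
  cancel : ∀ a x y → a +ℤ -1ℤ *ℤ x +ℤ 1ℤ *ℤ (x +ℤ -1ℤ *ℤ y) ≡ a +ℤ -1ℤ *ℤ y
  cancel = solve-∀

qq qq2 q2q2 negqq2 : Series
qq     = infProd (binom -1ℤ)
qq2    = infProd (oddFactors (binom -1ℤ))
q2q2   = infProd (evenFactors (binom -1ℤ))
negqq2 = infProd (oddFactors (binom 1ℤ))

invqq⊛qq≗one : invqq ⊛ qq ≗ one
invqq⊛qq≗one = begin
  invqq ⊛ qq                                    ≈⟨ infProd-⊛ Convergent-geom (Convergent-binom -1ℤ) ⟩
  infProd (λ k → geom k ⊛ binom -1ℤ k)          ≈⟨ infProd-cong (λ k → geom-⊛-binom k) ⟩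
  infProd (λ _ → one)                           ≈⟨ (λ n → prodTo-one n n) ⟩
  one                                           ∎
  where open SetoidReasoning (ℕ →-setoid _)

2*[2*k∸1]≡4*k∸2 : ∀ k → 2 * (2 * k ∸ 1) ≡ 4 * k ∸ 2
2*[2*k∸1]≡4*k∸2 k = trans (*-distribˡ-∸ 2 (2 * k) 1) (cong (_∸ 2) (sym (*-assoc 2 2 k)))

q2q2≗q2q4⊛q4q4 : q2q2 ≗ q2q4 ⊛ q4q4
q2q2≗q2q4⊛q4q4 = ≗.trans (infProd-odd-even (Convergent-even (Convergent-binom -1ℤ)))
  (⊛-cong (infProd-cong (λ k n → cong (λ d → binom -1ℤ d n) (2*[2*k∸1]≡4*k∸2 (suc k))))
          (infProd-cong (λ k n → cong (λ d → binom -1ℤ d n) (sym (*-assoc 2 2 (suc k))))))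

negqq2⊛qq2≗q2q4 : negqq2 ⊛ qq2 ≗ q2q4
negqq2⊛qq2≗q2q4 = ≗.trans
  (infProd-⊛ (Convergent-odd (Convergent-binom 1ℤ)) (Convergent-odd (Convergent-binom -1ℤ)))
  (infProd-cong (λ k n → trans (binom-⊛-binom (2 * suc k ∸ 1) n)
                               (cong (λ d → binom -1ℤ d n) (2*[2*k∸1]≡4*k∸2 (suc k)))))

rhsSeries≗negqq⊛negqq2 : rhsSeries ≗ negqq ⊛ negqq2
rhsSeries≗negqq⊛negqq2 = begin
  negqq ⊛ q2q4 ⊛ q2q4 ⊛ q4q4 ⊛ invqq
    ≈⟨ ⊛-congˡ invqq (⊛-assoc (negqq ⊛ q2q4) q2q4 q4q4) ⟩
  negqq ⊛ q2q4 ⊛ (q2q4 ⊛ q4q4) ⊛ invqq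
    ≈⟨ ⊛-congˡ invqq (⊛-cong (⊛-congʳ negqq (≗.sym negqq2⊛qq2≗q2q4)) (≗.sym q2q2≗q2q4⊛q4q4)) ⟩
  negqq ⊛ (negqq2 ⊛ qq2) ⊛ q2q2 ⊛ invqq
    ≈⟨ ⊛-congˡ invqq (⊛-congˡ q2q2 (≗.sym (⊛-assoc negqq negqq2 qq2))) ⟩
  negqq ⊛ negqq2 ⊛ qq2 ⊛ q2q2 ⊛ invqq
    ≈⟨ ⊛-congˡ invqq (⊛-assoc (negqq ⊛ negqq2) qq2 q2q2) ⟩
  negqq ⊛ negqq2 ⊛ (qq2 ⊛ q2q2) ⊛ invqq
    ≈⟨ ⊛-congˡ invqq (⊛-congʳ (negqq ⊛ negqq2) (≗.sym (infProd-odd-even (Convergent-binom -1ℤ)))) ⟩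
  negqq ⊛ negqq2 ⊛ qq ⊛ invqq
    ≈⟨ ⊛-assoc (negqq ⊛ negqq2) qq invqq ⟩
  negqq ⊛ negqq2 ⊛ (qq ⊛ invqq)
    ≈⟨ ⊛-congʳ (negqq ⊛ negqq2) (≗.trans (⊛-comm qq invqq) invqq⊛qq≗one) ⟩
  negqq ⊛ negqq2 ⊛ one
    ≈⟨ ⊛-identityʳ (negqq ⊛ negqq2) ⟩
  negqq ⊛ negqq2
    ∎
  where open SetoidReasoning (ℕ →-setoid _)

-- B s = Σₖ q^(sk+k²)/(q;q)ₖ is the limit of A s a as a → ∞. Both are computed by running the
-- recurrences B s = B (s+1) + q^(s+1) B (s+2) and A s a = A s (a+1) + q^a A (s+1) (a+1) for k steps;
-- the coefficient of qⁿ no longer changes once k is large compared to n.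
B-approx : ℕ → ℕ → Series
B-approx zero    s   = one
B-approx (suc k) s n = B-approx k (suc s) n +ℤ shift (suc s) (B-approx k (suc (suc s))) n

B-approx-step : ∀ k s {n} → n ≤ s + k → B-approx k s n ≡ B-approx (suc k) s n
B-approx-step zero    s {n} n≤s+0 =
  sym (trans (cong (one n +ℤ_) (shift-< (suc s) _ (s≤s (subst (n ≤_) (+-identityʳ s) n≤s+0))))
             (ℤ.+-identityʳ (one n)))
B-approx-step (suc k) s {n} n≤s+k+1 =
  cong₂ _+ℤ_ (B-approx-step k (suc s) (subst (n ≤_) (+-suc s k) n≤s+k+1))
             (shift-cong (suc s) n (λ m s+1+m≡n → B-approx-step k (suc (suc s)) (bound m s+1+m≡n)))
  where
  bound : ∀ m → suc s + m ≡ n → m ≤ suc (suc s) + k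
  bound m s+1+m≡n = ≤-trans (m≤n+m m (suc s)) (≤-trans (≤-reflexive s+1+m≡n)
                      (≤-trans n≤s+k+1 (≤-trans (≤-reflexive (+-suc s k)) (n≤1+n _))))

B : ℕ → Series
B s n = B-approx n s n

B-approx≡B : ∀ k s {n} → n ≤ s + k → B-approx k s n ≡ B s n
B-approx≡B k s {n} n≤s+k =
  constant-on-upset (λ k → B-approx k s n) (λ k → n ≤ s + k)
    (λ n≤s+k → ≤-trans n≤s+k (+-monoʳ-≤ s (n≤1+n _))) (B-approx-step _ s) n≤s+k (m≤n+m n s)

B-rec : ∀ s n → B s n ≡ B (suc s) n +ℤ shift (suc s) (B (suc (suc s))) n
B-rec s n = trans (sym (B-approx≡B (suc n) s (≤-trans (m≤n+m n s) (+-monoʳ-≤ s (n≤1+n n)))))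
  (cong₂ _+ℤ_ (B-approx≡B n (suc s) (≤-trans (m≤n+m n s) (n≤1+n _)))
              (shift-cong (suc s) n (λ m s+1+m≡n → B-approx≡B n (suc (suc s))
                 (≤-trans (≤-trans (m≤n+m m (suc s)) (≤-reflexive s+1+m≡n)) (m≤n+m n _)))))

B-below : ∀ {s n} → n ≤ s → B s n ≡ one n
B-below {s} {n} n≤s = sym (B-approx≡B 0 s (≤-trans n≤s (≤-reflexive (sym (+-identityʳ s)))))

A-approx : ℕ → ℕ → ℕ → Series
A-approx zero    s a   = B s
A-approx (suc k) s a n = A-approx k s (suc a) n +ℤ shift a (A-approx k (suc s) (suc a)) n

A-approx-rec-s : ∀ k s a n →
  A-approx k s a n ≡ A-approx k (suc s) a n +ℤ shift (suc s) (A-approx k (suc (suc s)) (suc a)) n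
A-approx-rec-s zero    s a n = B-rec s n
A-approx-rec-s (suc k) s a n = begin
  A-approx k s (suc a) n +ℤ shift a (A-approx k (suc s) (suc a)) n
    ≡⟨ cong₂ _+ℤ_ (A-approx-rec-s k s (suc a) n) (shift-cong a n (λ m _ → A-approx-rec-s k (suc s) (suc a) m)) ⟩
  (X +ℤ shift (suc s) Y n) +ℤ shift a (λ m → Z m +ℤ shift (2 + s) W m) n
    ≡⟨ cong ((X +ℤ shift (suc s) Y n) +ℤ_) (shift-+ a Z (shift (2 + s) W) n) ⟩
  (X +ℤ shift (suc s) Y n) +ℤ (shift a Z n +ℤ shift a (shift (2 + s) W) n)
    ≡⟨ cong (λ t → (X +ℤ shift (suc s) Y n) +ℤ (shift a Z n +ℤ t)) shift-commute ⟩
  (X +ℤ shift (suc s) Y n) +ℤ (shift a Z n +ℤ shift (suc s) (shift (suc a) W) n)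
    ≡⟨ interchange X (shift (suc s) Y n) (shift a Z n) (shift (suc s) (shift (suc a) W) n) ⟩
  (X +ℤ shift a Z n) +ℤ (shift (suc s) Y n +ℤ shift (suc s) (shift (suc a) W) n)
    ≡⟨ cong ((X +ℤ shift a Z n) +ℤ_) (sym (shift-+ (suc s) Y (shift (suc a) W) n)) ⟩
  (X +ℤ shift a Z n) +ℤ shift (suc s) (λ m → Y m +ℤ shift (suc a) W m) n
    ∎
  where
  open ≡-Reasoning
  X : ℤ
  X = A-approx k (suc s) (suc a) n
  Y Z W : Series
  Y = A-approx k (2 + s) (2 + a)
  Z = A-approx k (2 + s) (suc a)
  W = A-approx k (3 + s) (2 + a)
  shift-commute : shift a (shift (2 + s) W) n ≡ shift (suc s) (shift (suc a) W) n
  shift-commute = trans (shift-shift a (2 + s) W n)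
    (trans (cong (λ d → shift d W n) (trans (+-suc a (suc s)) (cong suc (trans (+-comm a (suc s)) (sym (+-suc s a))))))
           (sym (shift-shift (suc s) (suc a) W n)))
  interchange : ∀ x y z w → (x +ℤ y) +ℤ (z +ℤ w) ≡ (x +ℤ z) +ℤ (y +ℤ w)
  interchange = solve-∀

A-approx-step : ∀ k s a {n} → n < a + k → A-approx k s a n ≡ A-approx (suc k) s a n
A-approx-step zero    s a {n} n<a+0 =
  sym (trans (cong (B s n +ℤ_) (shift-< a _ (subst (n <_) (+-identityʳ a) n<a+0))) (ℤ.+-identityʳ _))
A-approx-step (suc k) s a {n} n<a+k+1 =
  cong₂ _+ℤ_ (A-approx-step k s (suc a) n<a+1+k)
             (shift-cong a n (λ m a+m≡n → A-approx-step k (suc s) (suc a)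
                (≤-trans (s≤s (≤-trans (m≤n+m m a) (≤-reflexive a+m≡n))) n<a+1+k)))
  where
  n<a+1+k : n < suc a + k
  n<a+1+k = subst (n <_) (+-suc a k) n<a+k+1

A : ℕ → ℕ → Series
A s a n = A-approx (suc n) s a n

A-approx≡A : ∀ k s a {n} → n < a + k → A-approx k s a n ≡ A s a n
A-approx≡A k s a {n} n<a+k =
  constant-on-upset (λ k → A-approx k s a n) (λ k → n < a + k)
    (λ n<a+k → ≤-trans n<a+k (+-monoʳ-≤ a (n≤1+n _))) (A-approx-step _ s a) n<a+k (m≤n+m (suc n) a)

A-rec-a : ∀ s a n → A s a n ≡ A s (suc a) n +ℤ shift a (A (suc s) (suc a)) n
A-rec-a s a n = cong₂ _+ℤ_ (A-approx≡A n s (suc a) (s≤s (m≤n+m n a)))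
  (shift-cong a n (λ m a+m≡n → A-approx≡A n (suc s) (suc a)
     (s≤s (≤-trans (≤-trans (m≤n+m m a) (≤-reflexive a+m≡n)) (m≤n+m n a)))))

A-rec-s : ∀ s a n → A s a n ≡ A (suc s) a n +ℤ shift (suc s) (A (suc (suc s)) (suc a)) n
A-rec-s s a n = trans (A-approx-rec-s (suc n) s a n)
  (cong (A (suc s) a n +ℤ_) (shift-cong (suc s) n (λ m s+1+m≡n → A-approx≡A (suc n) (suc (suc s)) (suc a)
     (s≤s (≤-trans (≤-trans (m≤n+m m (suc s)) (≤-reflexive s+1+m≡n)) (≤-trans (n≤1+n n) (m≤n+m (suc n) a)))))))

A-below : ∀ s {a n} → n < a → A s a n ≡ B s n
A-below s {a} {n} n<a = sym (A-approx≡A 0 s a (subst (n <_) (sym (+-identityʳ a)) n<a))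

A-approx-saturated : ∀ k {s s′} a {n} → n ≤ s → n ≤ s′ → A-approx k s a n ≡ A-approx k s′ a n
A-approx-saturated zero    a n≤s n≤s′ = trans (B-below n≤s) (sym (B-below n≤s′))
A-approx-saturated (suc k) {s} {s′} a {n} n≤s n≤s′ =
  cong₂ _+ℤ_ (A-approx-saturated k (suc a) n≤s n≤s′)
             (shift-cong a n (λ m a+m≡n → A-approx-saturated k (suc a) (bound n≤s a+m≡n) (bound n≤s′ a+m≡n)))
  where
  bound : ∀ {m t} → n ≤ t → a + m ≡ n → m ≤ suc t
  bound {m} n≤t a+m≡n = ≤-trans (≤-trans (m≤n+m m a) (≤-reflexive a+m≡n)) (≤-trans n≤t (n≤1+n _))

A-saturated : ∀ {s s′ n} a → n ≤ s → n ≤ s′ → A s a n ≡ A s′ a n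
A-saturated {n = n} a = A-approx-saturated (suc n) a

-- D a is the limit of A s a as s → ∞, namely (-q^a;q)∞.
D : ℕ → Series
D a n = A n a n

D-rec : ∀ a n → D a n ≡ D (suc a) n +ℤ shift a (D (suc a)) n
D-rec a n = trans (A-rec-a n a n) (cong (D (suc a) n +ℤ_) (shift-cong a n (λ m a+m≡n →
  A-saturated (suc a) (≤-trans (≤-trans (m≤n+m m a) (≤-reflexive a+m≡n)) (n≤1+n n)) ≤-refl)))

D-below : ∀ {a n} → n < a → D a n ≡ one n
D-below {a} {n} n<a = trans (A-below n n<a) (B-below ≤-refl)

A-1-rec : ∀ s n → A s 1 n ≡ A (2 + s) 1 n +ℤ shift (suc s) (A (2 + s) 1) n
A-1-rec s n = begin
  A s 1 n
    ≡⟨ A-rec-s s 1 n ⟩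
  A (1 + s) 1 n +ℤ shift (1 + s) (A (2 + s) 2) n
    ≡⟨ cong (_+ℤ shift (1 + s) (A (2 + s) 2) n) (A-rec-s (1 + s) 1 n) ⟩
  A (2 + s) 1 n +ℤ shift (2 + s) (A (3 + s) 2) n +ℤ shift (1 + s) (A (2 + s) 2) n
    ≡⟨ swap (A (2 + s) 1 n) _ _ ⟩
  A (2 + s) 1 n +ℤ (shift (1 + s) (A (2 + s) 2) n +ℤ shift (2 + s) (A (3 + s) 2) n)
    ≡⟨ cong (λ t → A (2 + s) 1 n +ℤ (shift (1 + s) (A (2 + s) 2) n +ℤ t))
            (trans (cong (λ d → shift d (A (3 + s) 2) n) (+-comm 1 (suc s))) (sym (shift-shift (1 + s) 1 _ n))) ⟩
  A (2 + s) 1 n +ℤ (shift (1 + s) (A (2 + s) 2) n +ℤ shift (1 + s) (shift 1 (A (3 + s) 2)) n)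
    ≡⟨ cong (A (2 + s) 1 n +ℤ_) (sym (shift-+ (1 + s) _ _ n)) ⟩
  A (2 + s) 1 n +ℤ shift (1 + s) (λ m → A (2 + s) 2 m +ℤ shift 1 (A (3 + s) 2) m) n
    ≡⟨ cong (A (2 + s) 1 n +ℤ_) (shift-cong (1 + s) n (λ m _ → sym (A-rec-a (2 + s) 1 m))) ⟩
  A (2 + s) 1 n +ℤ shift (suc s) (A (2 + s) 1) n
    ∎
  where
  open ≡-Reasoning
  swap : ∀ x y z → x +ℤ y +ℤ z ≡ x +ℤ (z +ℤ y)
  swap = solve-∀

recurrence⇒binom-⊛ : ∀ d {X} (Y : Series) → (∀ n → X n ≡ Y n +ℤ shift d Y n) → X ≗ binom 1ℤ d ⊛ Y
recurrence⇒binom-⊛ d {X} Y X≡ n =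
  trans (X≡ n) (trans (cong (Y n +ℤ_) (sym (ℤ.*-identityˡ (shift d Y n)))) (sym (binom-⊛ 1ℤ d Y n)))

D1≗negqq : D 1 ≗ negqq
D1≗negqq = ≗.trans
  (telescope (λ j → D (suc j)) (binom 1ℤ) one (Convergent-binom 1ℤ)
     (λ j → recurrence⇒binom-⊛ (suc j) (D (2 + j)) (D-rec (suc j))) (λ J n n≤J → D-below (s≤s n≤J)))
  (⊛-identityʳ negqq)

A01≗negqq⊛negqq2 : A 0 1 ≗ negqq ⊛ negqq2
A01≗negqq⊛negqq2 = ≗.trans
  (telescope (λ j → A (2 * j) 1) (oddFactors (binom 1ℤ)) (D 1) (Convergent-odd (Convergent-binom 1ℤ))
     step (λ J n n≤J → A-saturated 1 (≤-trans n≤J (m≤n*m J 2)) ≤-refl))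
  (≗.trans (⊛-congʳ negqq2 D1≗negqq) (⊛-comm negqq2 negqq))
  where
  step : ∀ j → A (2 * j) 1 ≗ binom 1ℤ (2 * suc j ∸ 1) ⊛ A (2 * suc j) 1
  step j = subst (λ t → A (2 * j) 1 ≗ binom 1ℤ (t ∸ 1) ⊛ A t 1) (sym (*-suc 2 j))
                 (recurrence⇒binom-⊛ (suc (2 * j)) (A (2 + 2 * j) 1) (A-1-rec (2 * j)))

E H : ℕ → Series
E p = A p (suc p)
H p = A (suc p) (suc p)

H-rec : ∀ p n → H p n ≡ E (suc p) n +ℤ shift (suc p) (H (suc p)) n
H-rec p = A-rec-a (suc p) (suc p)

E-rec : ∀ p n →
  E p n ≡ E (suc p) n +ℤ (shift (suc p) (H (suc p)) n +ℤ shift (suc p) (H (suc p)) n)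
E-rec p n = begin
  A p (1 + p) n
    ≡⟨ A-rec-a p (1 + p) n ⟩
  A p (2 + p) n +ℤ shift (1 + p) (A (1 + p) (2 + p)) n
    ≡⟨ cong (_+ℤ shift (1 + p) (A (1 + p) (2 + p)) n) (A-rec-s p (2 + p) n) ⟩
  A (1 + p) (2 + p) n +ℤ shift (1 + p) (A (2 + p) (3 + p)) n +ℤ shift (1 + p) (A (1 + p) (2 + p)) n
    ≡⟨ ℤ.+-assoc (A (1 + p) (2 + p) n) _ _ ⟩
  A (1 + p) (2 + p) n +ℤ (shift (1 + p) (A (2 + p) (3 + p)) n +ℤ shift (1 + p) (A (1 + p) (2 + p)) n)
    ≡⟨ cong (A (1 + p) (2 + p) n +ℤ_) (sym (shift-+ (1 + p) _ _ n)) ⟩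
  A (1 + p) (2 + p) n +ℤ shift (1 + p) (λ m → A (2 + p) (3 + p) m +ℤ A (1 + p) (2 + p) m) n
    ≡⟨ cong (A (1 + p) (2 + p) n +ℤ_) (shift-cong (1 + p) n (λ m _ → doubling m)) ⟩
  A (1 + p) (2 + p) n +ℤ shift (1 + p) (λ m → H (suc p) m +ℤ H (suc p) m) n
    ≡⟨ cong (A (1 + p) (2 + p) n +ℤ_) (shift-+ (1 + p) _ _ n) ⟩
  E (suc p) n +ℤ (shift (suc p) (H (suc p)) n +ℤ shift (suc p) (H (suc p)) n)
    ∎
  where
  open ≡-Reasoning
  -- both sides are expanded into A (2+p) (3+p) and q^(2+p) A (3+p) (3+p)
  doubling : ∀ m → A (2 + p) (3 + p) m +ℤ A (1 + p) (2 + p) m ≡ H (suc p) m +ℤ H (suc p) m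
  doubling m = begin
    y +ℤ A (1 + p) (2 + p) m        ≡⟨ cong (y +ℤ_) (A-rec-s (1 + p) (2 + p) m) ⟩
    y +ℤ (h +ℤ z)                   ≡⟨ regroup y h z ⟩
    h +ℤ (y +ℤ z)                   ≡⟨ cong (h +ℤ_) (sym (A-rec-a (2 + p) (2 + p) m)) ⟩
    h +ℤ h                          ∎
    where
    y h z : ℤ
    y = A (2 + p) (3 + p) m
    h = A (2 + p) (2 + p) m
    z = shift (2 + p) (A (3 + p) (3 + p)) m
    regroup : ∀ y h z → y +ℤ (h +ℤ z) ≡ h +ℤ (y +ℤ z)
    regroup = solve-∀

EH-below : ∀ {p n} → n ≤ p → E p n ≡ one n × H p n ≡ one n
EH-below n≤p = trans (A-below _ (s≤s n≤p)) (B-below n≤p)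
               , trans (A-below _ (s≤s n≤p)) (B-below (≤-trans n≤p (n≤1+n _)))

Disjoint-++ : ∀ {X : Set} {xs ys zs : List X} → Disjoint xs ys → Disjoint xs zs → Disjoint xs (ys ++ zs)
Disjoint-++ {ys = ys} xs#ys xs#zs (v∈xs , v∈ys++zs) with ∈-++⁻ ys v∈ys++zs
... | inj₁ v∈ys = xs#ys (v∈xs , v∈ys)
... | inj₂ v∈zs = xs#zs (v∈xs , v∈zs)

length-++ℤ : ∀ {X : Set} (xs ys : List X) → + length (xs ++ ys) ≡ + length xs +ℤ + length ys
length-++ℤ xs ys = trans (cong +_ (length-++ xs)) (ℤ.pos-+ (length xs) (length ys))

Linked-∷ : ∀ {X : Set} {R : X → X → Set} {x xs} → All (R x) xs → Linked R xs → Linked R (x ∷ xs)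
Linked-∷ []        _ = [-]
Linked-∷ (Rxy ∷ _) l = Rxy ∷ l

Linked-head-All : ∀ {X : Set} {R : X → X → Set} → Transitive R → ∀ {x xs} → Linked R (x ∷ xs) → All (R x) xs
Linked-head-All R-trans [-]       = []
Linked-head-All R-trans (Rxy ∷ l) = Linked⇒All R-trans Rxy l

reverseAcc-Linked : ∀ {X : Set} {R : X → X → Set} {acc xs} → Linked R acc → Linked (flip R) xs →
                    Connected R (Data.List.head xs) (Data.List.head acc) → Linked R (reverseAcc acc xs)
reverseAcc-Linked {xs = []}     lacc _    _    = lacc
reverseAcc-Linked {xs = x ∷ xs} lacc lxs conn =
  reverseAcc-Linked (conn Linked.∷′ lacc) (Linked.tail lxs) (Connected.sym (λ r → r) (Linked.head′ lxs))

Linked-reverse : ∀ {X : Set} {R : X → X → Set} {xs} → Linked (flip R) xs → Linked R (reverse xs)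
Linked-reverse {xs = []}    lxs = []
Linked-reverse {xs = _ ∷ _} lxs = reverseAcc-Linked [] lxs just-nothing

All-reverse : ∀ {X : Set} {P : X → Set} {xs} → All P xs → All P (reverse xs)
All-reverse {xs = xs} = All-resp-↭ (↭-sym (↭-reverse xs))

partSum≡sum : ∀ xs → partSum xs ≡ sum (map proj₁ xs)
partSum≡sum xs = sym (foldr-map _+_ proj₁ 0 xs)

partSum-reverse : ∀ xs → partSum (reverse xs) ≡ partSum xs
partSum-reverse xs = trans (partSum≡sum (reverse xs))
  (trans (sum-↭ (map⁺ proj₁ (↭-reverse xs))) (sym (partSum≡sum xs)))

partsOf-reverseAcc : ∀ c acc xs → partsOf c (reverseAcc acc xs) ≡ reverseAcc (partsOf c acc) (partsOf c xs)
partsOf-reverseAcc c acc []             = refl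
partsOf-reverseAcc c acc ((a , d) ∷ xs) = trans (partsOf-reverseAcc c ((a , d) ∷ acc) xs) move
  where
  move : reverseAcc (partsOf c ((a , d) ∷ acc)) (partsOf c xs) ≡ reverseAcc (partsOf c acc) (partsOf c ((a , d) ∷ xs))
  move with sameColor c d
  ... | true  = refl
  ... | false = refl

partsOf-reverse : ∀ c xs → partsOf c (reverse xs) ≡ reverse (partsOf c xs)
partsOf-reverse c = partsOf-reverseAcc c []

_<ᵖ_ : ℕ × Bool → ℕ × Bool → Set
x <ᵖ y = proj₁ x < proj₁ y

Follows : ℕ → Maybe Bool → ColPart → Set
Follows p nothing  r = ⊤
Follows p (just c) r = All (flip GapTwo p) (partsOf c r)

-- Partitions are listed in increasing order here. Tail p (just c) n r: r may follow a part p of colour c.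
record Tail (p : ℕ) (f : Maybe Bool) (n : ℕ) (r : ColPart) : Set where
  constructor mkTail
  field
    above     : All (λ x → p < proj₁ x) r
    ascending : Linked _<ᵖ_ r
    gaps      : ∀ c → Linked (flip GapTwo) (partsOf c r)
    follows   : Follows p f r
    sum≡      : partSum r ≡ n

Allowed : Maybe Bool → Bool → Set
Allowed nothing  c = ⊤
Allowed (just d) c = c ≢ d

partsOf-All : ∀ {P : ℕ → Set} c r → All (λ x → P (proj₁ x)) r → All P (partsOf c r)
partsOf-All c []            []         = []
partsOf-All c ((a , d) ∷ r) (pa ∷ pr) with sameColor c d
... | true  = pa ∷ partsOf-All c r pr
... | false = partsOf-All c r pr

partsOf-∷-≢ : ∀ {c d} a r → d ≢ c → partsOf c ((a , d) ∷ r) ≡ partsOf c r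
partsOf-∷-≢ {true}  {true}  a r d≢c = contradiction refl d≢c
partsOf-∷-≢ {true}  {false} a r d≢c = refl
partsOf-∷-≢ {false} {true}  a r d≢c = refl
partsOf-∷-≢ {false} {false} a r d≢c = contradiction refl d≢c

gaps-∷ : ∀ {a c r} → (∀ b → Linked (flip GapTwo) (partsOf b r)) → All (flip GapTwo a) (partsOf c r) →
         ∀ b → Linked (flip GapTwo) (partsOf b ((a , c) ∷ r))
gaps-∷ {c = true}  gs fa true  = Linked-∷ fa (gs true)
gaps-∷ {c = true}  gs fa false = gs false
gaps-∷ {c = false} gs fa true  = gs true
gaps-∷ {c = false} gs fa false = Linked-∷ fa (gs false)

gaps-tail : ∀ {a c r} → (∀ b → Linked (flip GapTwo) (partsOf b ((a , c) ∷ r))) →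
            ∀ b → Linked (flip GapTwo) (partsOf b r)
gaps-tail {c = true}  gs true  = Linked.tail (gs true)
gaps-tail {c = true}  gs false = gs false
gaps-tail {c = false} gs true  = gs true
gaps-tail {c = false} gs false = Linked.tail (gs false)

GapTwo-trans : Transitive (flip GapTwo)
GapTwo-trans {a} {b} {c} a+2≤b b+2≤c = ≤-trans a+2≤b (≤-trans (m≤m+n b 2) b+2≤c)

gaps-head : ∀ {a c r} → Linked (flip GapTwo) (partsOf c ((a , c) ∷ r)) → All (flip GapTwo a) (partsOf c r)
gaps-head {c = true}  = Linked-head-All GapTwo-trans
gaps-head {c = false} = Linked-head-All GapTwo-trans

above⇒Follows : ∀ {p} c r → All (λ x → suc p < proj₁ x) r → All (flip GapTwo p) (partsOf c r)
above⇒Follows {p} c r above = partsOf-All c r (All.map (λ {x} → subst (_≤ proj₁ x) (+-comm 2 p)) above)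

shiftL : ∀ {X : Set} → ℕ → (ℕ → List X) → ℕ → List X
shiftL zero    F n       = F n
shiftL (suc d) F zero    = []
shiftL (suc d) F (suc n) = shiftL d F n

shiftL-∈⁻ : ∀ {X : Set} d (F : ℕ → List X) n {v} → v ∈ shiftL d F n → ∃ λ m → d + m ≡ n × v ∈ F m
shiftL-∈⁻ zero    F n       v∈ = n , refl , v∈
shiftL-∈⁻ (suc d) F (suc n) v∈ with shiftL-∈⁻ d F n v∈
... | m , d+m≡n , v∈Fm = m , cong suc d+m≡n , v∈Fm

shiftL-∈⁺ : ∀ {X : Set} d (F : ℕ → List X) {n m v} → d + m ≡ n → v ∈ F m → v ∈ shiftL d F n
shiftL-∈⁺ zero    F         refl v∈ = v∈
shiftL-∈⁺ (suc d) F {suc n} e    v∈ = shiftL-∈⁺ d F (suc-injective e) v∈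

shiftL-unique : ∀ {X : Set} d (F : ℕ → List X) n → (∀ m → Unique (F m)) → Unique (shiftL d F n)
shiftL-unique zero    F n       u = u n
shiftL-unique (suc d) F zero    u = []
shiftL-unique (suc d) F (suc n) u = shiftL-unique d F n u

shiftL-length : ∀ {X : Set} d (F : ℕ → List X) n → + length (shiftL d F n) ≡ shift d (λ m → + length (F m)) n
shiftL-length zero    F n       = refl
shiftL-length (suc d) F zero    = refl
shiftL-length (suc d) F (suc n) = shiftL-length d F n

emptyOnly : ℕ → List ColPart
emptyOnly zero    = [] ∷ []
emptyOnly (suc _) = []

-- Scans the positions p + 1, …, p + k, choosing for each whether it is a part and of which colour.
tails     : ℕ → ℕ → Maybe Bool → ℕ → List ColPart
tailsFrom : ℕ → ℕ → Bool → ℕ → List ColPart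
tails zero    p f        n = emptyOnly n
tails (suc k) p nothing  n = tails k (suc p) nothing n ++ (tailsFrom k p true n ++ tailsFrom k p false n)
tails (suc k) p (just c) n = tails k (suc p) nothing n ++ tailsFrom k p (not c) n
tailsFrom k p c = shiftL (suc p) (λ m → map ((suc p , c) ∷_) (tails k (suc p) (just c) m))

tailsFrom-∈⁻ : ∀ k p c n {v} → v ∈ tailsFrom k p c n →
               ∃ λ m → suc p + m ≡ n × Σ ColPart λ r → r ∈ tails k (suc p) (just c) m × v ≡ (suc p , c) ∷ r
tailsFrom-∈⁻ k p c n v∈ with shiftL-∈⁻ (suc p) _ n v∈
... | m , e , v∈m with ∈-map⁻ ((suc p , c) ∷_) v∈m
...   | r , r∈ , v≡ = m , e , r , r∈ , v≡

Tail-weaken : ∀ {p n r} f → Tail (suc p) nothing n r → Tail p f n r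
Tail-weaken {p} {n} {r} f (mkTail above ascending gaps _ sum≡) =
  mkTail (All.map (<-trans (n<1+n p)) above) ascending gaps (follows f) sum≡
  where
  follows : ∀ f → Follows p f r
  follows nothing  = tt
  follows (just c) = above⇒Follows c r above

Tail-∷ : ∀ {p f m n c r} → Allowed f c → suc p + m ≡ n → Tail (suc p) (just c) m r → Tail p f n ((suc p , c) ∷ r)
Tail-∷ {p} {f} {c = c} {r} allowed e (mkTail above ascending gaps follows sum≡) =
  mkTail (≤-refl ∷ All.map (<-trans (n<1+n p)) above) (Linked-∷ above ascending) (gaps-∷ {r = r} gaps follows)
         (follows′ f allowed) (trans (cong (λ s → suc p + s) sum≡) e)
  where
  follows′ : ∀ f → Allowed f c → Follows p f ((suc p , c) ∷ r)
  follows′ nothing  _   = tt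
  follows′ (just d) c≢d = subst (All (flip GapTwo p)) (sym (partsOf-∷-≢ (suc p) r c≢d)) (above⇒Follows d r above)

not-Allowed : ∀ c → Allowed (just c) (not c)
not-Allowed true  ()
not-Allowed false ()

tails-sound     : ∀ k p f n {r} → r ∈ tails k p f n → Tail p f n r
tailsFrom-sound : ∀ k p f c n {r} → Allowed f c → r ∈ tailsFrom k p c n → Tail p f n r
tails-sound zero    p f        zero (here refl) = mkTail [] [] (λ _ → []) (follows f) refl
  where
  follows : ∀ f → Follows p f []
  follows nothing  = tt
  follows (just c) = []
tails-sound (suc k) p nothing  n r∈ with ∈-++⁻ (tails k (suc p) nothing n) r∈
... | inj₁ r∈₁ = Tail-weaken nothing (tails-sound k (suc p) nothing n r∈₁)
... | inj₂ r∈₂ with ∈-++⁻ (tailsFrom k p true n) r∈₂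
...   | inj₁ r∈₃ = tailsFrom-sound k p nothing true n tt r∈₃
...   | inj₂ r∈₃ = tailsFrom-sound k p nothing false n tt r∈₃
tails-sound (suc k) p (just c) n r∈ with ∈-++⁻ (tails k (suc p) nothing n) r∈
... | inj₁ r∈₁ = Tail-weaken (just c) (tails-sound k (suc p) nothing n r∈₁)
... | inj₂ r∈₂ = tailsFrom-sound k p (just c) (not c) n (not-Allowed c) r∈₂
tailsFrom-sound k p f c n allowed r∈ with tailsFrom-∈⁻ k p c n r∈
... | m , e , r , r∈′ , refl = Tail-∷ allowed e (tails-sound k (suc p) (just c) m r∈′)

Tail-uncons : ∀ {p f n c r} → Tail p f n ((suc p , c) ∷ r) → Allowed f c × Tail (suc p) (just c) (partSum r) r
Tail-uncons {p} {f} {c = c} {r} (mkTail _ ascending gaps follows _) =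
  allowed f follows ,
  mkTail (Linked-head-All <-trans ascending) (Linked.tail ascending)
         (gaps-tail {suc p} {c} {r} gaps) (gaps-head {suc p} {c} {r} (gaps c)) refl
  where
  cannot-follow : ∀ c → ¬ All (flip GapTwo p) (partsOf c ((suc p , c) ∷ r))
  cannot-follow true  (p+2≤p+1 ∷ _) = <-irrefl refl (subst (_≤ suc p) (+-comm p 2) p+2≤p+1)
  cannot-follow false (p+2≤p+1 ∷ _) = <-irrefl refl (subst (_≤ suc p) (+-comm p 2) p+2≤p+1)
  allowed : ∀ f → Follows p f ((suc p , c) ∷ r) → Allowed f c
  allowed nothing  _       = tt
  allowed (just d) follows refl = cannot-follow c follows

Tail-skip : ∀ {p f n x c r} → x ≢ suc p → Tail p f n ((x , c) ∷ r) → Tail (suc p) nothing n ((x , c) ∷ r)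
Tail-skip {p} {x = x} x≢ (mkTail (p<x ∷ _) ascending gaps _ sum≡) =
  mkTail (p+1<x ∷ All.map (<-trans p+1<x) (Linked-head-All <-trans ascending)) ascending gaps tt sum≡
  where
  p+1<x : suc p < x
  p+1<x = ≤∧≢⇒< p<x (λ e → x≢ (sym e))

Allowed-just : ∀ {c d} → Allowed (just d) c → c ≡ not d
Allowed-just {true}  {true}  c≢d = contradiction refl c≢d
Allowed-just {true}  {false} c≢d = refl
Allowed-just {false} {true}  c≢d = refl
Allowed-just {false} {false} c≢d = contradiction refl c≢d

tails-∈-skip : ∀ k p f n {v} → v ∈ tails k (suc p) nothing n → v ∈ tails (suc k) p f n
tails-∈-skip k p nothing  n v∈ = ∈-++⁺ˡ v∈
tails-∈-skip k p (just c) n v∈ = ∈-++⁺ˡ v∈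

tails-∈-from : ∀ k p f c n {v} → Allowed f c → v ∈ tailsFrom k p c n → v ∈ tails (suc k) p f n
tails-∈-from k p nothing  true  n _       v∈ =
  ∈-++⁺ʳ (tails k (suc p) nothing n) (∈-++⁺ˡ v∈)
tails-∈-from k p nothing  false n _       v∈ =
  ∈-++⁺ʳ (tails k (suc p) nothing n) (∈-++⁺ʳ (tailsFrom k p true n) v∈)
tails-∈-from k p (just d) c     n allowed v∈ =
  ∈-++⁺ʳ (tails k (suc p) nothing n) (subst (λ c → _ ∈ tailsFrom k p c n) (Allowed-just allowed) v∈)

tails-complete : ∀ k p f n {r} → n < suc p + k → Tail p f n r → r ∈ tails k p f n
tails-complete zero    p f .0 {[]}          _ (mkTail _ _ _ _ refl) = here refl
tails-complete zero    p f n  {(x , c) ∷ r} n<p+1+0 (mkTail (p<x ∷ _) _ _ _ sum≡) =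
  contradiction (≤-trans (m≤m+n x (partSum r)) (≤-reflexive sum≡))
                (<⇒≱ (<-≤-trans (subst (n <_) (+-identityʳ (suc p)) n<p+1+0) p<x))
tails-complete (suc k) p f n  {[]}          n<p+1+k+1 T =
  tails-∈-skip k p f n (tails-complete k (suc p) nothing n (subst (n <_) (+-suc (suc p) k) n<p+1+k+1)
                          (mkTail [] [] (λ _ → []) tt (Tail.sum≡ T)))
tails-complete (suc k) p f n  {(x , c) ∷ r} n<p+1+k+1 T with x ≟ suc p
... | yes refl = tails-∈-from k p f c n allowed
                   (shiftL-∈⁺ (suc p) _ (Tail.sum≡ T) (∈-map⁺ ((suc p , c) ∷_)
                      (tails-complete k (suc p) (just c) (partSum r) bound T′)))
  where
  allowed : Allowed f c
  allowed = proj₁ (Tail-uncons T)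
  T′ : Tail (suc p) (just c) (partSum r) r
  T′ = proj₂ (Tail-uncons T)
  bound : partSum r < suc (suc p) + k
  bound = ≤-trans (+-cancelˡ-< (suc p) _ _ (subst (_< suc p + suc k) (sym (Tail.sum≡ T)) n<p+1+k+1))
                  (s≤s (≤-trans (m≤n+m k p) (n≤1+n _)))
... | no x≢ = tails-∈-skip k p f n (tails-complete k (suc p) nothing n (subst (n <_) (+-suc (suc p) k) n<p+1+k+1)
                                       (Tail-skip x≢ T))

emptyOnly-unique : ∀ n → Unique (emptyOnly n)
emptyOnly-unique zero    = [] ∷ []
emptyOnly-unique (suc n) = []

skip#from : ∀ k p c n → Disjoint (tails k (suc p) nothing n) (tailsFrom k p c n)
skip#from k p c n (v∈₁ , v∈₂) with tailsFrom-∈⁻ k p c n v∈₂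
... | _ , _ , _ , _ , refl with Tail.above (tails-sound k (suc p) nothing n v∈₁)
...   | p+1<p+1 ∷ _ = <-irrefl refl p+1<p+1

true#false : ∀ k p n → Disjoint (tailsFrom k p true n) (tailsFrom k p false n)
true#false k p n (v∈₁ , v∈₂) with tailsFrom-∈⁻ k p true n v∈₁ | tailsFrom-∈⁻ k p false n v∈₂
... | _ , _ , _ , _ , refl | _ , _ , _ , _ , ()

tails-unique     : ∀ k p f n → Unique (tails k p f n)
tailsFrom-unique : ∀ k p c n → Unique (tailsFrom k p c n)
tails-unique zero    p f        n = emptyOnly-unique n
tails-unique (suc k) p nothing  n =
  Unique.++⁺ (tails-unique k (suc p) nothing n)
             (Unique.++⁺ (tailsFrom-unique k p true n) (tailsFrom-unique k p false n) (true#false k p n))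
             (Disjoint-++ (skip#from k p true n) (skip#from k p false n))
tails-unique (suc k) p (just c) n =
  Unique.++⁺ (tails-unique k (suc p) nothing n) (tailsFrom-unique k p (not c) n) (skip#from k p (not c) n)
tailsFrom-unique k p c n =
  shiftL-unique (suc p) _ n (λ m → Unique.map⁺ ∷-injectiveʳ (tails-unique k (suc p) (just c) m))

emptyOnly-length : ∀ n → + length (emptyOnly n) ≡ one n
emptyOnly-length zero    = refl
emptyOnly-length (suc n) = refl

tailsFrom-length : ∀ k p c n →
  + length (tailsFrom k p c n) ≡ shift (suc p) (λ m → + length (tails k (suc p) (just c) m)) n
tailsFrom-length k p c n = trans (shiftL-length (suc p) _ n)
  (shift-cong (suc p) n (λ m _ → cong +_ (length-map ((suc p , c) ∷_) (tails k (suc p) (just c) m))))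

tails-length : ∀ k p n → n < suc p + k →
  + length (tails k p nothing n) ≡ E p n × (∀ c → + length (tails k p (just c) n) ≡ H p n)
tails-length zero    p n n<p+1+0 =
  trans (emptyOnly-length n) (sym (proj₁ below)) , λ c → trans (emptyOnly-length n) (sym (proj₂ below))
  where
  below : E p n ≡ one n × H p n ≡ one n
  below = EH-below (≤-pred (subst (n <_) (+-identityʳ (suc p)) n<p+1+0))
tails-length (suc k) p n n<p+1+k+1 =
  (begin
    + length (skip ++ (tailsFrom k p true n ++ tailsFrom k p false n))
      ≡⟨ trans (length-++ℤ skip _) (cong (+ length skip +ℤ_) (length-++ℤ (tailsFrom k p true n) _)) ⟩
    + length skip +ℤ (+ length (tailsFrom k p true n) +ℤ + length (tailsFrom k p false n))
      ≡⟨ cong₂ _+ℤ_ (proj₁ (tails-length k (suc p) n n<p+2+k))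
                    (cong₂ _+ℤ_ (from-length true) (from-length false)) ⟩
    E (suc p) n +ℤ (shift (suc p) (H (suc p)) n +ℤ shift (suc p) (H (suc p)) n)
      ≡⟨ sym (E-rec p n) ⟩
    E p n
      ∎) ,
  λ c → begin
    + length (skip ++ tailsFrom k p (not c) n)
      ≡⟨ length-++ℤ skip _ ⟩
    + length skip +ℤ + length (tailsFrom k p (not c) n)
      ≡⟨ cong₂ _+ℤ_ (proj₁ (tails-length k (suc p) n n<p+2+k)) (from-length (not c)) ⟩
    E (suc p) n +ℤ shift (suc p) (H (suc p)) n
      ≡⟨ sym (H-rec p n) ⟩
    H p n
      ∎
  where
  open ≡-Reasoning
  skip : List ColPart
  skip = tails k (suc p) nothing n
  n<p+2+k : n < suc (suc p) + k
  n<p+2+k = subst (n <_) (+-suc (suc p) k) n<p+1+k+1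
  from-length : ∀ c → + length (tailsFrom k p c n) ≡ shift (suc p) (H (suc p)) n
  from-length c = trans (tailsFrom-length k p c n) (shift-cong (suc p) n (λ m p+1+m≡n →
    proj₂ (tails-length k (suc p) m (≤-trans (s≤s (≤-trans (m≤n+m m (suc p)) (≤-reflexive p+1+m≡n))) n<p+2+k)) c))

IsRR2⇒Tail : ∀ {n p} → IsRR2 n p → Tail 0 nothing n (reverse p)
IsRR2⇒Tail {n} {p} (positive , descending , gapsTrue , gapsFalse , sum≡) =
  mkTail (All-reverse positive) (Linked-reverse descending) gaps tt (trans (partSum-reverse p) sum≡)
  where
  gaps : ∀ c → Linked (flip GapTwo) (partsOf c (reverse p))
  gaps true  = subst (Linked (flip GapTwo)) (sym (partsOf-reverse true p)) (Linked-reverse gapsTrue)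
  gaps false = subst (Linked (flip GapTwo)) (sym (partsOf-reverse false p)) (Linked-reverse gapsFalse)

Tail⇒IsRR2 : ∀ {n r} → Tail 0 nothing n r → IsRR2 n (reverse r)
Tail⇒IsRR2 {n} {r} (mkTail above ascending gaps _ sum≡) =
  All-reverse above , Linked-reverse ascending , gaps-reverse true , gaps-reverse false ,
  trans (partSum-reverse r) sum≡
  where
  gaps-reverse : ∀ c → Linked GapTwo (partsOf c (reverse r))
  gaps-reverse c = subst (Linked GapTwo) (sym (partsOf-reverse c r)) (Linked-reverse (gaps c))

theorem1p2 : (n : ℕ) → Σ (List ColPart) (λ L →
      Unique L
    × ((p : ColPart) → p ∈ L → IsRR2 n p)
    × ((p : ColPart) → IsRR2 n p → p ∈ L)
    × (+ length L) ≡ rhsSeries n)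
theorem1p2 n = map reverse candidates , unique , sound , complete , count
  where
  candidates : List ColPart
  candidates = tails (suc n) 0 nothing n
  unique : Unique (map reverse candidates)
  unique = Unique.map⁺ reverse-injective (tails-unique (suc n) 0 nothing n)
  sound : (p : ColPart) → p ∈ map reverse candidates → IsRR2 n p
  sound p p∈ with ∈-map⁻ reverse p∈
  ... | r , r∈ , refl = Tail⇒IsRR2 (tails-sound (suc n) 0 nothing n r∈)
  complete : (p : ColPart) → IsRR2 n p → p ∈ map reverse candidates
  complete p rr = subst (_∈ map reverse candidates) (reverse-involutive p)
    (∈-map⁺ reverse (tails-complete (suc n) 0 nothing n (s≤s (n≤1+n n)) (IsRR2⇒Tail rr)))
  count : + length (map reverse candidates) ≡ rhsSeries n
  count = begin
    + length (map reverse candidates)  ≡⟨ cong +_ (length-map reverse candidates) ⟩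
    + length candidates                ≡⟨ proj₁ (tails-length (suc n) 0 n (s≤s (n≤1+n n))) ⟩
    E 0 n                              ≡⟨ A01≗negqq⊛negqq2 n ⟩
    (negqq ⊛ negqq2) n                 ≡⟨ sym (rhsSeries≗negqq⊛negqq2 n) ⟩
    rhsSeries n                        ∎
    where open ≡-Reasoning
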